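{- For all integers $d\ge2$ and $n\ge1$ there is a natural bijection between the set of $(d-1)$-fold iterated partitions of $n$ and the set of C4 games of size $n$ in $\mathbb{N}^d$.
   Context: A 1-fold iterated partition of a positive integer $n$ is a partition of $n$, i.e. a finite multiset of positive integers with sum $n$; for $q>1$, a $q$-fold iterated partition of $n$ is a finite multiset $\{p_1,\dots,p_h\}$ where each $p_i$ is a $(q-1)$-fold iterated partition of a positive integer $n_i$ and $\sum n_i=n$. A standard set is a subset $\Delta\subseteq\mathbb{N}^d$ whose complement $C$ satisfies $C+\mathbb{N}^d=C$. A C4 game of size $n$ in $\mathbb{N}^d$ is: for $d=1,2$, a standard set $\Delta\subseteq\mathbb{N}^d$ of cardinality $n$; for $d>2$, a finite multiset $\{g_1,\dots,g_h\}$ where each $g_i$ is a C4 game of some size $n_i\ge1$ in $\mathbb{N}^{d-1}$ and $\sum n_i=n$. -}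

module Defs where

open import Level using (0ℓ)
open import Data.Nat using (ℕ; zero; suc; _+_; _≤_)
open import Data.List using (List; map; length)
open import Data.Nat.ListAction using (sum)
open import Data.List.Relation.Unary.All using (All)
open import Data.List.Relation.Unary.Unique.Propositional using (Unique)
open import Data.List.Membership.Propositional using (_∈_; _∉_)
open import Data.List.Relation.Binary.BagAndSetEquality using ([_]-Equality; set)
import Data.List.Relation.Binary.Permutation.Setoid as Perm
open import Data.Vec using (Vec; zipWith)
open import Data.Product using (Σ; ∃; ∃-syntax; _×_; proj₁)
open import Data.Unit using (⊤)
open import Function.Bundles using (_⇔_)
open import Relation.Binary.Bundles using (Setoid)
open import Relation.Binary.PropositionalEquality using (_≡_; setoid)
import Relation.Binary.Construct.On as On

Multiset : Setoid 0ℓ 0ℓ → Setoid 0ℓ 0ℓ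
Multiset S = Perm.↭-setoid S

SubSetoid : (S : Setoid 0ℓ 0ℓ) → (Setoid.Carrier S → Set) → Setoid 0ℓ 0ℓ
SubSetoid S P = On.setoid {B = Σ (Setoid.Carrier S) P} S proj₁

-- Level 0: a positive integer m (viewed as the
-- "0-fold" object of size m); level q+1: a finite multiset of level-q
-- objects.  A 1-fold iterated partition of n is then a multiset of
-- positive integers summing to n, and a (q+1)-fold one (q ≥ 1) is a
-- multiset of q-fold iterated partitions of positive integers n_i
-- with Σ n_i = n.

IPRaw : ℕ → Setoid 0ℓ 0ℓ
IPRaw zero    = setoid ℕ
IPRaw (suc q) = Multiset (IPRaw q)

ipSize : (q : ℕ) → Setoid.Carrier (IPRaw q) → ℕ
ipSize zero    m  = m
ipSize (suc q) ps = sum (map (ipSize q) ps)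

IPValid : (q : ℕ) → Setoid.Carrier (IPRaw q) → Set
IPValid zero    m  = ⊤
IPValid (suc q) ps = All (λ p → IPValid q p × 1 ≤ ipSize q p) ps

-- The set of q-fold iterated partitions of n (meaningful for q ≥ 1).
IteratedPartitions : (q n : ℕ) → Setoid 0ℓ 0ℓ
IteratedPartitions q n =
  SubSetoid (IPRaw q) (λ p → IPValid q p × ipSize q p ≡ n)

Point : ℕ → Set
Point d = Vec ℕ d

_⊕_ : ∀ {d} → Point d → Point d → Point d
_⊕_ = zipWith _+_

FinSubsets : ℕ → Setoid 0ℓ 0ℓ
FinSubsets d = [ set ]-Equality (Point d)

-- complement C of Δ satisfies C + ℕ^d = C, i.e.
-- x ∈ C  ⇔  ∃ c ∈ C, v ∈ ℕ^d with x = c + v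
IsStandard : ∀ d → List (Point d) → Set
IsStandard d Δ =
  (x : Point d) → (x ∉ Δ) ⇔ (∃[ c ] ∃[ v ] (c ∉ Δ × x ≡ c ⊕ v))

-- validity: a duplicate-free listing (so that its length is the
-- cardinality) of a standard set
StdValid : ∀ d → List (Point d) → Set
StdValid d Δ = Unique Δ × IsStandard d Δ

-- d = 1, 2 : standard sets (d = 0 is outside the paper's scope; it is
-- given the same clause only to make the definition total).
-- d > 2   : finite multisets of C4 games of positive size in ℕ^(d-1).

GameRaw : ℕ → Setoid 0ℓ 0ℓ
GameRaw (suc (suc (suc k))) = Multiset (GameRaw (suc (suc k)))
GameRaw d                   = FinSubsets d

gameSize : (d : ℕ) → Setoid.Carrier (GameRaw d) → ℕ
gameSize (suc (suc (suc k))) gs = sum (map (gameSize (suc (suc k))) gs)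
gameSize zero                Δ  = length Δ
gameSize (suc zero)          Δ  = length Δ
gameSize (suc (suc zero))    Δ  = length Δ

GameValid : (d : ℕ) → Setoid.Carrier (GameRaw d) → Set
GameValid (suc (suc (suc k))) gs =
  All (λ g → GameValid (suc (suc k)) g × 1 ≤ gameSize (suc (suc k)) g) gs
GameValid zero                Δ  = StdValid zero Δ
GameValid (suc zero)          Δ  = StdValid (suc zero) Δ
GameValid (suc (suc zero))    Δ  = StdValid (suc (suc zero)) Δ

C4Games : (d n : ℕ) → Setoid 0ℓ 0ℓ
C4Games d n = SubSetoid (GameRaw d) (λ g → GameValid d g × gameSize d g ≡ n)

module Submission where

-- Both sides are built by the same recursion: a (q+1)-fold iterated
-- partition is a multiset of q-fold ones of positive size, and for d ≥ 3 a
-- C4 game in ℕ^d is a multiset of C4 games of positive size in ℕ^(d-1).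
-- Phrasing both as graded families (raw objects, validity, size), the
-- theorem follows from a lifting lemma -- a size-preserving correspondence
-- of valid objects lifts to multisets of positive-size objects -- and from
-- the base case d = 2: partitions of n ↔ standard sets of size n in ℕ².
--
-- The base case is the Young diagram correspondence.  A partition ps is sent
-- to the diagram whose column i has height exceed ps i = #{p ∈ ps | i < p};
-- a finite set is sent to its nonzero row lengths.  It then shows that standard sets are
-- the down-closed sets, that a down-closed set of ℕ² is determined by its
-- column heights, and that the column heights of a down-closed set are
-- exceed of its row lengths (conjugation).  Both round trips follow.

open import Defs
open import Level using (0ℓ)
open import Data.Nat
open import Data.Nat.Properties
open import Algebra.Properties.CommutativeSemigroup +-commutativeSemigroup using (interchange)
open import Data.Nat.ListAction using (sum)
open import Data.Nat.ListAction.Properties using (sum-↭)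
open import Data.List using (List; []; _∷_; _++_; map; length; applyDownFrom)
open import Data.List.Properties using (length-++; length-applyDownFrom; map-id)
open import Data.List.Extrema.Nat using (max; xs≤max; max-mono-⊆)
open import Data.List.Membership.Propositional using (_∈_)
open import Data.List.Membership.Propositional.Properties
  using (∈-∃++; ∈-++⁻; ∈-++⁺ˡ; ∈-++⁺ʳ; ∈-applyDownFrom⁺; ∈-applyDownFrom⁻; ∈-map⁺)
open import Data.List.Membership.Propositional.Properties.WithK using (unique∧set⇒bag)
import Data.List.Membership.DecPropositional as DecMembership
open import Data.List.Relation.Binary.BagAndSetEquality using (_∼[_]_; set; ∼bag⇒↭)
open import Data.List.Relation.Binary.Permutation.Propositional
  using (_↭_; ↭-refl; ↭-prep; ↭-sym; ↭-trans; ↭-reflexive; ↭⇒↭ₛ; ↭ₛ⇒↭)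
open import Data.List.Relation.Binary.Permutation.Propositional.Properties
  using (All-resp-↭; shift; ↭-length)
import Data.List.Relation.Binary.Permutation.Propositional.Properties as Perm
import Data.List.Relation.Binary.Permutation.Setoid as SetoidPerm
import Data.List.Relation.Binary.Permutation.Setoid.Properties as SetoidPerm
open import Data.List.Relation.Binary.Pointwise using (Pointwise; []; _∷_)
open import Data.List.Relation.Binary.Subset.Propositional.Properties using () renaming (map⁺ to ⊆-map⁺)
open import Data.List.Relation.Unary.All using (All; []; _∷_)
import Data.List.Relation.Unary.All as All
import Data.List.Relation.Unary.All.Properties as All
open import Data.List.Relation.Unary.AllPairs using ([])
open import Data.List.Relation.Unary.Any using (here; there)
open import Data.List.Relation.Unary.Unique.Propositional using (Unique)
import Data.List.Relation.Unary.Unique.Propositional.Properties as Unique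
open import Data.Vec using ([]; _∷_; replicate)
import Data.Vec.Properties as Vec
open import Data.Vec.Relation.Binary.Pointwise.Inductive using ([]; _∷_) renaming (Pointwise to Pointwiseᵥ)
open import Data.Product using (_×_; _,_; ∃-syntax; proj₁; proj₂; map₁; map₂)
open import Data.Sum using (inj₁; inj₂)
open import Data.Unit using (tt)
open import Function using (id; _∘′_)
open import Function.Bundles using (_⇔_; mk⇔; Equivalence; Inverse)
open import Function.Related.Propositional using (module EquationalReasoning)
open import Relation.Binary.Bundles using (Setoid)
open import Relation.Binary.PropositionalEquality
open import Relation.Nullary using (Dec; yes; no; ¬_; contradiction)
open import Relation.Unary using (Decidable)

open Equivalence using (to; from)

𝟙 : {P : Set} → Dec P → ℕ
𝟙 (yes _) = 1
𝟙 (no _)  = 0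

𝟙-mono : {P Q : Set} (p : Dec P) (q : Dec Q) → (P → Q) → 𝟙 p ≤ 𝟙 q
𝟙-mono (yes p) (yes _) _   = ≤-refl
𝟙-mono (yes p) (no ¬q) P⇒Q = contradiction (P⇒Q p) ¬q
𝟙-mono (no _)  _       _   = z≤n

𝟙-yes : {P : Set} (p : Dec P) → P → 𝟙 p ≡ 1
𝟙-yes (yes _) _  = refl
𝟙-yes (no ¬p) pr = contradiction pr ¬p

𝟙-no : {P : Set} (p : Dec P) → ¬ P → 𝟙 p ≡ 0
𝟙-no (yes pr) ¬p = contradiction pr ¬p
𝟙-no (no _)   _  = refl

𝟙-cong : {P Q : Set} (p : Dec P) (q : Dec Q) → P ⇔ Q → 𝟙 p ≡ 𝟙 q
𝟙-cong p q P⇔Q = ≤-antisym (𝟙-mono p q (to P⇔Q)) (𝟙-mono q p (from P⇔Q))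

sumBelow : (ℕ → ℕ) → ℕ → ℕ
sumBelow f zero    = 0
sumBelow f (suc B) = f B + sumBelow f B

sumBelow-cong : ∀ {f g} → (∀ i → f i ≡ g i) → ∀ B → sumBelow f B ≡ sumBelow g B
sumBelow-cong f≗g zero    = refl
sumBelow-cong f≗g (suc B) = cong₂ _+_ (f≗g B) (sumBelow-cong f≗g B)

sumBelow-+ : ∀ f g B → sumBelow (λ i → f i + g i) B ≡ sumBelow f B + sumBelow g B
sumBelow-+ f g zero    = refl
sumBelow-+ f g (suc B) =
  trans (cong (f B + g B +_) (sumBelow-+ f g B)) (interchange (f B) (g B) _ _)

sumBelow-zero : ∀ B → sumBelow (λ _ → 0) B ≡ 0
sumBelow-zero zero    = refl
sumBelow-zero (suc B) = sumBelow-zero B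

countBelow : {P : ℕ → Set} → Decidable P → ℕ → ℕ
countBelow P? = sumBelow (λ i → 𝟙 (P? i))

countBelow-all : {P : ℕ → Set} (P? : Decidable P) → ∀ B → (∀ i → i < B → P i) → countBelow P? B ≡ B
countBelow-all P? zero    _   = refl
countBelow-all P? (suc B) all with P? B
... | yes _  = cong suc (countBelow-all P? B (λ i i<B → all i (m<n⇒m<1+n i<B)))
... | no ¬pB = contradiction (all B ≤-refl) ¬pB

Threshold : (ℕ → Set) → ℕ → Set
Threshold P m = ∀ i → P i ⇔ i < m

Downward : (ℕ → Set) → Set
Downward P = ∀ {i j} → i ≤ j → P j → P i

below⇒≤ : ∀ {m m′} → (∀ i → i < m → i < m′) → m ≤ m′
below⇒≤ {zero}  _ = z≤n
below⇒≤ {suc m} h = h m ≤-refl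

threshold-unique : ∀ {P m m′} → Threshold P m → Threshold P m′ → m ≡ m′
threshold-unique t t′ = ≤-antisym (below⇒≤ (λ i → to (t′ i) ∘′ from (t i)))
                                  (below⇒≤ (λ i → to (t i) ∘′ from (t′ i)))

countBelow-threshold : {P : ℕ → Set} (P? : Decidable P) → Downward P →
  ∀ B → (∀ i → P i → i < B) → Threshold P (countBelow P? B)
countBelow-threshold {P} P? down zero    bound i = mk⇔ (bound i) (λ ())
countBelow-threshold {P} P? down (suc B) bound i with P? B
... | yes pB rewrite countBelow-all P? B (λ j j<B → down (<⇒≤ j<B) pB) =
  mk⇔ (bound i) (λ i<1+B → down (s≤s⁻¹ i<1+B) pB)
... | no ¬pB = countBelow-threshold P? down B bound′ i
  where
  bound′ : ∀ j → P j → j < B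
  bound′ j pj with m<1+n⇒m<n∨m≡n (bound j pj)
  ... | inj₁ j<B  = j<B
  ... | inj₂ refl = contradiction pj ¬pB

countIn : {A : Set} {P : A → Set} → Decidable P → List A → ℕ
countIn P? xs = sum (map (λ x → 𝟙 (P? x)) xs)

countIn-↭ : {A : Set} {P : A → Set} (P? : Decidable P) → ∀ {xs ys} → xs ↭ ys → countIn P? xs ≡ countIn P? ys
countIn-↭ P? xs↭ys = sum-↭ (Perm.map⁺ _ xs↭ys)

countIn-mono : {A : Set} {P Q : A → Set} (P? : Decidable P) (Q? : Decidable Q) →
  (∀ {x} → P x → Q x) → ∀ xs → countIn P? xs ≤ countIn Q? xs
countIn-mono P? Q? P⇒Q []       = z≤n
countIn-mono P? Q? P⇒Q (x ∷ xs) = +-mono-≤ (𝟙-mono (P? x) (Q? x) P⇒Q) (countIn-mono P? Q? P⇒Q xs)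

countIn-witness : {A : Set} {P Q : A → Set} (P? : Decidable P) (Q? : Decidable Q) →
  ∀ xs → countIn Q? xs < countIn P? xs → ∃[ y ] y ∈ xs × P y × ¬ Q y
countIn-witness P? Q? (x ∷ xs) lt with P? x | Q? x
... | yes px | no ¬qx = x , here refl , px , ¬qx
... | yes _  | yes _  = map₂ (map₁ there) (countIn-witness P? Q? xs (s≤s⁻¹ lt))
... | no _   | yes _  = map₂ (map₁ there) (countIn-witness P? Q? xs (<⇒≤ lt))
... | no _   | no _   = map₂ (map₁ there) (countIn-witness P? Q? xs lt)

∈⇒↭∷ : {A : Set} {x : A} {ys : List A} → x ∈ ys → ∃[ zs ] ys ↭ x ∷ zs
∈⇒↭∷ x∈ys with as , bs , refl ← ∈-∃++ x∈ys = as ++ bs , shift _ as bs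

-- exceed ps i = #{p ∈ ps | i < p}, the height of column i of the Young
-- diagram of the partition ps.
exceed : List ℕ → ℕ → ℕ
exceed ps i = countIn (i <?_) ps

exceed-antitone : ∀ ps {i i′} → i ≤ i′ → exceed ps i′ ≤ exceed ps i
exceed-antitone ps i≤i′ = countIn-mono _ _ (≤-<-trans i≤i′) ps

-- If exceed ys agrees with exceed (suc x ∷ xs), then ys has more parts
-- exceeding x than exceeding suc x ...
exceed-drop : ∀ x xs ys → (∀ i → exceed (suc x ∷ xs) i ≡ exceed ys i) → exceed ys (suc x) < exceed ys x
exceed-drop x xs ys same = begin-strict
  exceed ys (suc x)                      ≡⟨ sym (same (suc x)) ⟩
  𝟙 (suc x <? suc x) + exceed xs (suc x) ≡⟨ cong (_+ exceed xs (suc x)) (𝟙-no (suc x <? suc x) (<-irrefl refl)) ⟩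
  exceed xs (suc x)                      ≤⟨ exceed-antitone xs (n≤1+n x) ⟩
  exceed xs x                            <⟨ n<1+n (exceed xs x) ⟩
  1 + exceed xs x                        ≡⟨ cong (_+ exceed xs x) (𝟙-yes (x <? suc x) (n<1+n x)) ⟨
  𝟙 (x <? suc x) + exceed xs x           ≡⟨ same x ⟩
  exceed ys x                            ∎
  where open ≤-Reasoning

-- ... so some part y of ys satisfies x < y ≤ suc x, i.e. suc x is a part of ys.
head∈ : ∀ x xs ys → (∀ i → exceed (suc x ∷ xs) i ≡ exceed ys i) → suc x ∈ ys
head∈ x xs ys same
  with y , y∈ys , x<y , y≮1+x ← countIn-witness (x <?_) (suc x <?_) ys (exceed-drop x xs ys same) =
  subst (_∈ ys) (≤-antisym (≮⇒≥ y≮1+x) x<y) y∈ys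

exceed-injective : ∀ xs ys → All (1 ≤_) xs → All (1 ≤_) ys →
  (∀ i → exceed xs i ≡ exceed ys i) → xs ↭ ys
exceed-injective []           []           _         _        _    = ↭-refl
exceed-injective []           (suc y ∷ ys) _         _        same with () ← same 0
exceed-injective []           (zero ∷ ys)  _         (() ∷ _) _
exceed-injective (zero ∷ xs)  ys           (() ∷ _)  _        _
exceed-injective (suc x ∷ xs) ys           (_ ∷ xs⁺) ys⁺      same
  with zs , ys↭x∷zs ← ∈⇒↭∷ (head∈ x xs ys same) =
  ↭-trans (↭-prep (suc x) xs↭zs) (↭-sym ys↭x∷zs)
  where
  xs↭zs : xs ↭ zs
  xs↭zs = exceed-injective xs zs xs⁺ (All.tail (All-resp-↭ ys↭x∷zs ys⁺))
    (λ i → +-cancelˡ-≡ (𝟙 (i <? suc x)) _ _ (trans (same i) (countIn-↭ (i <?_) ys↭x∷zs)))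

_∈?_ : ∀ {d} (x : Point d) (Δ : List (Point d)) → Dec (x ∈ Δ)
_∈?_ = DecMembership._∈?_ (Vec.≡-dec _≟_)

_≼_ : ∀ {d} → Point d → Point d → Set
_≼_ = Pointwiseᵥ _≤_

≼-⊕ : ∀ {d} (c v : Point d) → c ≼ (c ⊕ v)
≼-⊕ []      []      = []
≼-⊕ (a ∷ c) (b ∷ v) = m≤m+n a b ∷ ≼-⊕ c v

≼⇒⊕ : ∀ {d} {c x : Point d} → c ≼ x → ∃[ v ] x ≡ c ⊕ v
≼⇒⊕ []                = [] , refl
≼⇒⊕ (_∷_ {x = a} {y = b} a≤b c≼x) with v , refl ← ≼⇒⊕ c≼x =
  b ∸ a ∷ v , cong (_∷ _) (sym (m+[n∸m]≡n a≤b))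

DownClosed : ∀ {d} → List (Point d) → Set
DownClosed Δ = ∀ {x y} → y ≼ x → x ∈ Δ → y ∈ Δ

-- Standard sets are exactly the down-closed sets: C + ℕ^d = C says that the
-- complement C is up-closed.
downClosed⇒standard : ∀ {d} (Δ : List (Point d)) → DownClosed Δ → IsStandard d Δ
downClosed⇒standard Δ down x = mk⇔
  (λ x∉Δ → x , replicate _ 0 , x∉Δ , sym (Vec.zipWith-identityʳ +-identityʳ x))
  (λ { (c , v , c∉Δ , refl) x∈Δ → c∉Δ (down (≼-⊕ c v) x∈Δ) })

standard⇒downClosed : ∀ {d} (Δ : List (Point d)) → IsStandard d Δ → DownClosed Δ
standard⇒downClosed Δ std {x} {y} y≼x x∈Δ with y ∈? Δ
... | yes y∈Δ = y∈Δ
... | no y∉Δ with v , x≡y⊕v ← ≼⇒⊕ y≼x = contradiction x∈Δ (from (std x) (y , v , y∉Δ , x≡y⊕v))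

pt : ℕ → ℕ → Point 2
pt i j = i ∷ j ∷ []

_≐_ : List (Point 2) → List (Point 2) → Set
_≐_ = Setoid._≈_ (FinSubsets 2)

HasColumns : List (Point 2) → (ℕ → ℕ) → Set
HasColumns Δ c = ∀ i j → pt i j ∈ Δ ⇔ j < c i

columns-unique : ∀ {Δ c c′} → HasColumns Δ c → HasColumns Δ c′ → ∀ i → c i ≡ c′ i
columns-unique hc hc′ i = threshold-unique (hc i) (hc′ i)

columns-sameSet : ∀ {Δ Δ′ c c′} → HasColumns Δ c → HasColumns Δ′ c′ → (∀ i → c i ≡ c′ i) → Δ ≐ Δ′
columns-sameSet hc hc′ c≗c′ {i ∷ j ∷ []} = mk⇔
  (λ ij∈Δ  → from (hc′ i j) (subst (j <_) (c≗c′ i) (to (hc i j) ij∈Δ)))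
  (λ ij∈Δ′ → from (hc i j) (subst (j <_) (sym (c≗c′ i)) (to (hc′ i j) ij∈Δ′)))

columns-downClosed : ∀ {Δ c} → (∀ {i i′} → i ≤ i′ → c i′ ≤ c i) → HasColumns Δ c → DownClosed Δ
columns-downClosed antitone hc {i ∷ j ∷ []} {i′ ∷ j′ ∷ []} (i′≤i ∷ j′≤j ∷ []) ij∈Δ =
  from (hc i′ j′) (≤-<-trans j′≤j (<-≤-trans (to (hc i j) ij∈Δ) (antitone i′≤i)))

column : ℕ → ℕ → List (Point 2)
column i k = applyDownFrom (pt i) k

diagramOf : (ℕ → ℕ) → ℕ → List (Point 2)
diagramOf c zero    = []
diagramOf c (suc S) = column S (c S) ++ diagramOf c S

diagramOf-∈⁻ : ∀ c S {i j} → pt i j ∈ diagramOf c S → i < S × j < c i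
diagramOf-∈⁻ c (suc S) ij∈ with ∈-++⁻ (column S (c S)) ij∈
... | inj₁ ∈column with _ , j<cS , refl ← ∈-applyDownFrom⁻ (pt S) ∈column = ≤-refl , j<cS
... | inj₂ ∈rest = map₁ m<n⇒m<1+n (diagramOf-∈⁻ c S ∈rest)

diagramOf-∈⁺ : ∀ c S {i j} → i < S → j < c i → pt i j ∈ diagramOf c S
diagramOf-∈⁺ c (suc S) i<1+S j<ci with m<1+n⇒m<n∨m≡n i<1+S
... | inj₁ i<S  = ∈-++⁺ʳ (column S (c S)) (diagramOf-∈⁺ c S i<S j<ci)
... | inj₂ refl = ∈-++⁺ˡ (∈-applyDownFrom⁺ (pt S) j<ci)

diagramOf-unique : ∀ c S → Unique (diagramOf c S)
diagramOf-unique c zero    = []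
diagramOf-unique c (suc S) = Unique.++⁺ column-unique (diagramOf-unique c S) disjoint
  where
  column-unique : Unique (column S (c S))
  column-unique = Unique.applyDownFrom⁺₁ (pt S) (c S)
    (λ j<k _ eq → <⇒≢ j<k (sym (Vec.∷-injectiveˡ (Vec.∷-injectiveʳ eq))))
  disjoint : ∀ {v} → ¬ (v ∈ column S (c S) × v ∈ diagramOf c S)
  disjoint (∈column , ∈rest) with _ , _ , refl ← ∈-applyDownFrom⁻ (pt S) ∈column =
    <-irrefl refl (proj₁ (diagramOf-∈⁻ c S ∈rest))

diagramOf-length : ∀ c S → length (diagramOf c S) ≡ sumBelow c S
diagramOf-length c zero    = refl
diagramOf-length c (suc S) = trans (length-++ (column S (c S)))
  (cong₂ _+_ (length-applyDownFrom (pt S) (c S)) (diagramOf-length c S))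

diagramOf-columns : ∀ c S → (∀ {i} → 0 < c i → i < S) → HasColumns (diagramOf c S) c
diagramOf-columns c S bounded i j = mk⇔
  (λ ij∈ → proj₂ (diagramOf-∈⁻ c S ij∈))
  (λ j<ci → diagramOf-∈⁺ c S (bounded (≤-<-trans z≤n j<ci)) j<ci)

total : Point 2 → ℕ
total (i ∷ j ∷ []) = i + j

-- A bound for the coordinates of the points of Δ that depends only on the
-- set Δ.
bound : List (Point 2) → ℕ
bound Δ = suc (max 0 (map total Δ))

bound-∈ : ∀ Δ {i j} → pt i j ∈ Δ → i < bound Δ × j < bound Δ
bound-∈ Δ {i} {j} ij∈Δ = s≤s (≤-trans (m≤m+n i j) i+j≤max) , s≤s (≤-trans (m≤n+m j i) i+j≤max)
  where
  i+j≤max : i + j ≤ max 0 (map total Δ)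
  i+j≤max = All.lookup (xs≤max 0 (map total Δ)) (∈-map⁺ total ij∈Δ)

bound-cong : ∀ {Δ Δ′} → Δ ≐ Δ′ → bound Δ ≡ bound Δ′
bound-cong Δ≐Δ′ = cong suc (≤-antisym (max-mono-⊆ ≤-refl (⊆-map⁺ total (to Δ≐Δ′)))
                                      (max-mono-⊆ ≤-refl (⊆-map⁺ total (from Δ≐Δ′))))

rowLength : List (Point 2) → ℕ → ℕ
rowLength Δ j = countBelow (λ i → pt i j ∈? Δ) (bound Δ)

rowLength-cong : ∀ {Δ Δ′} → Δ ≐ Δ′ → ∀ j → rowLength Δ j ≡ rowLength Δ′ j
rowLength-cong {Δ} {Δ′} Δ≐Δ′ j = trans
  (sumBelow-cong (λ i → 𝟙-cong (pt i j ∈? Δ) (pt i j ∈? Δ′) Δ≐Δ′) (bound Δ))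
  (cong (countBelow (λ i → pt i j ∈? Δ′)) (bound-cong Δ≐Δ′))

row-threshold : ∀ {Δ} → DownClosed Δ → ∀ j → Threshold (λ i → pt i j ∈ Δ) (rowLength Δ j)
row-threshold {Δ} down j = countBelow-threshold (λ i → pt i j ∈? Δ)
  (λ i≤i′ → down (i≤i′ ∷ ≤-refl ∷ [])) (bound Δ) (λ i ij∈Δ → proj₁ (bound-∈ Δ ij∈Δ))

_∷⁺_ : ℕ → List ℕ → List ℕ
zero  ∷⁺ ms = ms
suc m ∷⁺ ms = suc m ∷ ms

nonzeroValues : (ℕ → ℕ) → ℕ → List ℕ
nonzeroValues r zero    = []
nonzeroValues r (suc B) = r B ∷⁺ nonzeroValues r B

nonzeroValues-positive : ∀ r B → All (1 ≤_) (nonzeroValues r B)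
nonzeroValues-positive r zero    = []
nonzeroValues-positive r (suc B) with r B
... | zero  = nonzeroValues-positive r B
... | suc _ = s≤s z≤n ∷ nonzeroValues-positive r B

nonzeroValues-cong : ∀ {r r′} → (∀ j → r j ≡ r′ j) → ∀ B → nonzeroValues r B ≡ nonzeroValues r′ B
nonzeroValues-cong r≗r′ zero    = refl
nonzeroValues-cong r≗r′ (suc B) = cong₂ _∷⁺_ (r≗r′ B) (nonzeroValues-cong r≗r′ B)

exceed-nonzeroValues : ∀ r B i → exceed (nonzeroValues r B) i ≡ countBelow (λ j → i <? r j) B
exceed-nonzeroValues r zero    i = refl
exceed-nonzeroValues r (suc B) i with r B
... | zero  = exceed-nonzeroValues r B i
... | suc _ = cong (𝟙 (i <? _) +_) (exceed-nonzeroValues r B i)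

rowLengths : List (Point 2) → List ℕ
rowLengths Δ = nonzeroValues (rowLength Δ) (bound Δ)

rowLengths-positive : ∀ Δ → All (1 ≤_) (rowLengths Δ)
rowLengths-positive Δ = nonzeroValues-positive (rowLength Δ) (bound Δ)

rowLengths-cong : ∀ {Δ Δ′} → Δ ≐ Δ′ → rowLengths Δ ≡ rowLengths Δ′
rowLengths-cong {Δ} Δ≐Δ′ = trans (nonzeroValues-cong (rowLength-cong Δ≐Δ′) (bound Δ))
                                 (cong (nonzeroValues _) (bound-cong Δ≐Δ′))

-- Conjugation: the column heights of a down-closed set are counted by its
-- row lengths, since (i , j) ∈ Δ iff i < rowLength Δ j.
rowLengths-columns : ∀ {Δ} → DownClosed Δ → HasColumns Δ (exceed (rowLengths Δ))
rowLengths-columns {Δ} down i j = begin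
  pt i j ∈ Δ                                           ∼⟨ row-threshold down j i ⟩
  i < rowLength Δ j                                    ∼⟨ countBelow-threshold inColumn? downward (bound Δ) bounded j ⟩
  j < countBelow inColumn? (bound Δ)                   ≡⟨ cong (j <_) (exceed-nonzeroValues (rowLength Δ) (bound Δ) i) ⟨
  j < exceed (rowLengths Δ) i                          ∎
  where
  open EquationalReasoning
  inColumn? : ∀ j → Dec (i < rowLength Δ j)
  inColumn? j = i <? rowLength Δ j
  inRow : ∀ j → pt i j ∈ Δ ⇔ i < rowLength Δ j
  inRow j = row-threshold down j i
  downward : Downward (λ j → i < rowLength Δ j)
  downward j≤j′ i<row = to (inRow _) (down (≤-refl ∷ j≤j′ ∷ []) (from (inRow _) i<row))
  bounded : ∀ j → i < rowLength Δ j → j < bound Δ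
  bounded j i<row = proj₂ (bound-∈ Δ (from (inRow j) i<row))

diagram : List ℕ → List (Point 2)
diagram ps = diagramOf (exceed ps) (sum ps)

exceed⇒<sum : ∀ ps {i} → 0 < exceed ps i → i < sum ps
exceed⇒<sum (p ∷ ps) {i} pos with i <? p
... | yes i<p = <-≤-trans i<p (m≤m+n p (sum ps))
... | no  _   = <-≤-trans (exceed⇒<sum ps pos) (m≤n+m (sum ps) p)

diagram-columns : ∀ ps → HasColumns (diagram ps) (exceed ps)
diagram-columns ps = diagramOf-columns (exceed ps) (sum ps) (exceed⇒<sum ps)

diagram-downClosed : ∀ ps → DownClosed (diagram ps)
diagram-downClosed ps = columns-downClosed (exceed-antitone ps) (diagram-columns ps)

diagram-unique : ∀ ps → Unique (diagram ps)
diagram-unique ps = diagramOf-unique (exceed ps) (sum ps)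

countBelow-< : ∀ {p S} → p ≤ S → countBelow (_<? p) S ≡ p
countBelow-< {p} {S} p≤S = threshold-unique
  (countBelow-threshold (_<? p) ≤-<-trans S (λ i i<p → <-≤-trans i<p p≤S))
  (λ i → mk⇔ id id)

parts≤sum : ∀ ps → All (_≤ sum ps) ps
parts≤sum []       = []
parts≤sum (p ∷ ps) = m≤m+n p (sum ps) ∷ All.map (λ q≤ → ≤-trans q≤ (m≤n+m (sum ps) p)) (parts≤sum ps)

-- Σ_{i < S} exceed ps i = sum ps: a part p lies in the columns i < p.
sumBelow-exceed : ∀ ps {S} → All (_≤ S) ps → sumBelow (exceed ps) S ≡ sum ps
sumBelow-exceed []       {S} []             = sumBelow-zero S
sumBelow-exceed (p ∷ ps) {S} (p≤S ∷ ps≤S) = begin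
  sumBelow (exceed (p ∷ ps)) S                  ≡⟨ sumBelow-+ (λ i → 𝟙 (i <? p)) (exceed ps) S ⟩
  countBelow (_<? p) S + sumBelow (exceed ps) S ≡⟨ cong₂ _+_ (countBelow-< p≤S) (sumBelow-exceed ps ps≤S) ⟩
  p + sum ps                                    ∎
  where open ≡-Reasoning

diagram-length : ∀ ps → length (diagram ps) ≡ sum ps
diagram-length ps = trans (diagramOf-length (exceed ps) (sum ps)) (sumBelow-exceed ps (parts≤sum ps))

diagram-rowLengths : ∀ {Δ} → DownClosed Δ → diagram (rowLengths Δ) ≐ Δ
diagram-rowLengths {Δ} down =
  columns-sameSet (diagram-columns (rowLengths Δ)) (rowLengths-columns down) (λ _ → refl)

rowLengths-diagram : ∀ {ps} → All (1 ≤_) ps → rowLengths (diagram ps) ↭ ps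
rowLengths-diagram {ps} positive = exceed-injective (rowLengths (diagram ps)) ps (rowLengths-positive (diagram ps)) positive
  (columns-unique (rowLengths-columns (diagram-downClosed ps)) (diagram-columns ps))

sameSet-length : {A : Set} {xs ys : List A} → Unique xs → Unique ys → xs ∼[ set ] ys → length xs ≡ length ys
sameSet-length u u′ xs≈ys = ↭-length (∼bag⇒↭ (unique∧set⇒bag u u′ xs≈ys))

rowLengths-sum : ∀ {Δ} → Unique Δ → DownClosed Δ → sum (rowLengths Δ) ≡ length Δ
rowLengths-sum {Δ} unique down = trans (sym (diagram-length (rowLengths Δ)))
  (sameSet-length (diagram-unique (rowLengths Δ)) unique (diagram-rowLengths down))

record Graded : Set₁ where
  field
    Raw   : Setoid 0ℓ 0ℓ
    Valid : Setoid.Carrier Raw → Set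
    size  : Setoid.Carrier Raw → ℕ
  open Setoid Raw public using (Carrier; _≈_)

OfSize : Graded → ℕ → Setoid 0ℓ 0ℓ
OfSize F n = SubSetoid Raw (λ a → Valid a × size a ≡ n)
  where open Graded F

Multisets : Graded → Graded
Multisets F = record
  { Raw   = Multiset Raw
  ; Valid = All (λ a → Valid a × 1 ≤ size a)
  ; size  = λ as → sum (map size as)
  }
  where open Graded F

-- The two families of the theorem.  By the definitions, level q + 1 of the
-- first is Multisets of level q, and likewise for C4 games in dimension ≥ 3.
IteratedPartitionFamily : ℕ → Graded
IteratedPartitionFamily q = record { Raw = IPRaw q ; Valid = IPValid q ; size = ipSize q }

C4GameFamily : ℕ → Graded
C4GameFamily d = record { Raw = GameRaw d ; Valid = GameValid d ; size = gameSize d }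

record _≅_ (F G : Graded) : Set where
  private
    module F = Graded F
    module G = Graded G
  field
    forth       : F.Carrier → G.Carrier
    back        : G.Carrier → F.Carrier
    forth-cong  : ∀ {a a′} → a F.≈ a′ → forth a G.≈ forth a′
    back-cong   : ∀ {b b′} → b G.≈ b′ → back b F.≈ back b′
    forth-valid : ∀ {a} → F.Valid a → G.Valid (forth a)
    back-valid  : ∀ {b} → G.Valid b → F.Valid (back b)
    forth-size  : ∀ {a} → F.Valid a → G.size (forth a) ≡ F.size a
    back-size   : ∀ {b} → G.Valid b → F.size (back b) ≡ G.size b
    forth-back  : ∀ {b} → G.Valid b → forth (back b) G.≈ b
    back-forth  : ∀ {a} → F.Valid a → back (forth a) F.≈ a

restrict : ∀ {F G} → F ≅ G → ∀ n → Inverse (OfSize F n) (OfSize G n)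
restrict {F} {G} F≅G n = record
  { to        = λ { (a , valid , a≡n) → forth a , forth-valid valid , trans (forth-size valid) a≡n }
  ; from      = λ { (b , valid , b≡n) → back b , back-valid valid , trans (back-size valid) b≡n }
  ; to-cong   = forth-cong
  ; from-cong = back-cong
  ; inverse   = (λ { {_ , valid , _} b≈ → G.trans (forth-cong b≈) (forth-back valid) })
              , (λ { {_ , valid , _} a≈ → F.trans (back-cong a≈) (back-forth valid) })
  }
  where
  open _≅_ F≅G
  module F = Setoid (Graded.Raw F)
  module G = Setoid (Graded.Raw G)

sum-map-map : {A B : Set} {P : A → Set} (f : A → B) (sizeA : A → ℕ) (sizeB : B → ℕ) →
  (∀ {a} → P a → sizeB (f a) ≡ sizeA a) →
  ∀ {as} → All P as → sum (map sizeB (map f as)) ≡ sum (map sizeA as)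
sum-map-map f sizeA sizeB same []         = refl
sum-map-map f sizeA sizeB same (pa ∷ pas) = cong₂ _+_ (same pa) (sum-map-map f sizeA sizeB same pas)

pointwise-map-map : {A B : Set} {P : A → Set} (_≈_ : A → A → Set) (f : A → B) (g : B → A) →
  (∀ {a} → P a → g (f a) ≈ a) → ∀ {as} → All P as → Pointwise _≈_ (map g (map f as)) as
pointwise-map-map _≈_ f g inverse []         = []
pointwise-map-map _≈_ f g inverse (pa ∷ pas) = inverse pa ∷ pointwise-map-map _≈_ f g inverse pas

lift : ∀ {F G} → F ≅ G → Multisets F ≅ Multisets G
lift {F} {G} F≅G = record
  { forth       = map forth
  ; back        = map back
  ; forth-cong  = SetoidPerm.map⁺ F.Raw G.Raw forth-cong
  ; back-cong   = SetoidPerm.map⁺ G.Raw F.Raw back-cong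
  ; forth-valid = λ valid → All.map⁺ (All.map (λ (v , pos) → forth-valid v , positive (forth-size v) pos) valid)
  ; back-valid  = λ valid → All.map⁺ (All.map (λ (v , pos) → back-valid v , positive (back-size v) pos) valid)
  ; forth-size  = sum-map-map forth F.size G.size (λ (v , _) → forth-size v)
  ; back-size   = sum-map-map back G.size F.size (λ (v , _) → back-size v)
  ; forth-back  = λ valid → SetoidPerm.↭-reflexive-≋ G.Raw
                    (pointwise-map-map G._≈_ back forth (λ (v , _) → forth-back v) valid)
  ; back-forth  = λ valid → SetoidPerm.↭-reflexive-≋ F.Raw
                    (pointwise-map-map F._≈_ forth back (λ (v , _) → back-forth v) valid)
  }
  where
  open _≅_ F≅G
  module F = Graded F
  module G = Graded G
  positive : ∀ {m n} → m ≡ n → 1 ≤ n → 1 ≤ m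
  positive m≡n = subst (1 ≤_) (sym m≡n)

partitions≅standardSets : IteratedPartitionFamily 1 ≅ C4GameFamily 2
partitions≅standardSets = record
  { forth       = diagram
  ; back        = rowLengths
  ; forth-cong  = λ {ps} {ps′} ps↭ps′ → columns-sameSet (diagram-columns ps) (diagram-columns ps′)
                                         (λ i → countIn-↭ (i <?_) (↭ₛ⇒↭ ps↭ps′))
  ; back-cong   = λ Δ≐Δ′ → ↭⇒↭ₛ (↭-reflexive (rowLengths-cong Δ≐Δ′))
  ; forth-valid = λ {ps} _ → diagram-unique ps , downClosed⇒standard (diagram ps) (diagram-downClosed ps)
  ; back-valid  = λ {Δ} _ → All.map (tt ,_) (rowLengths-positive Δ)
  ; forth-size  = λ {ps} _ → trans (diagram-length ps) (cong sum (sym (map-id ps)))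
  ; back-size   = λ {Δ} (unique , std) → trans (cong sum (map-id (rowLengths Δ)))
                                              (rowLengths-sum unique (standard⇒downClosed Δ std))
  ; forth-back  = λ {Δ} (_ , std) → diagram-rowLengths (standard⇒downClosed Δ std)
  ; back-forth  = λ valid → ↭⇒↭ₛ (rowLengths-diagram (All.map proj₂ valid))
  }

iteratedPartitions≅c4Games : ∀ k → IteratedPartitionFamily (suc k) ≅ C4GameFamily (suc (suc k))
iteratedPartitions≅c4Games zero    = partitions≅standardSets
iteratedPartitions≅c4Games (suc k) = lift (iteratedPartitions≅c4Games k)

propositionB4 : (d n : ℕ) → 2 ≤ d → 1 ≤ n →
    Inverse (IteratedPartitions (d ∸ 1) n) (C4Games d n)
propositionB4 (suc (suc k)) n _ _ = restrict (iteratedPartitions≅c4Games k) n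
propositionB4 (suc zero)    n (s≤s ()) _
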